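{- Let $G$ be a graph of order $n$ and let $t\ge 3$ be an integer. If $\gamma(S(G,t))=n^{t-1}\gamma(G)$, then there exists a unique $\gamma(G)$-set.
   Context: A set $D\subseteq V$ is dominating in $G=(V,E)$ if every vertex of $V\setminus D$ has a neighbour in $D$; the domination number $\gamma(G)$ is the minimum cardinality of a dominating set, and a dominating set of cardinality $\gamma(G)$ is a $\gamma(G)$-set. For a positive integer $t$, $V^t$ denotes the set of words $u=u_1\cdots u_t$ of length $t$ over $V$. The generalized Sierpiński graph $S(G,t)$ has vertex set $V^t$, and $\{u,v\}$ is an edge if and only if there is $i\in\{1,\dots,t\}$ such that: (i) $u_j=v_j$ for all $j<i$; (ii) $u_i\ne v_i$ and $\{u_i,v_i\}\in E$; (iii) $u_j=v_i$ and $v_j=u_i$ for all $j>i$. -}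

module Defs where

open import Level using (Level; 0ℓ)
open import Data.Nat using (ℕ; _*_; _^_; _∸_; _≤_)
open import Data.Fin using (Fin; _<_)
open import Data.Vec using (Vec; lookup)
open import Data.List using (List; length)
open import Data.List.Membership.Propositional using (_∈_)
open import Data.List.Relation.Unary.Unique.Propositional using (Unique)
open import Data.Product using (Σ; _×_; ∃; ∃-syntax)
open import Data.Sum using (_⊎_)
open import Relation.Nullary using (¬_)
open import Relation.Binary.PropositionalEquality using (_≡_; refl)
import Relation.Binary.PropositionalEquality
open import Data.Product using (_,_)

record Graph (V : Set) : Set₁ where
  field
    Adj   : V → V → Set
    sym   : ∀ {x y} → Adj x y → Adj y x
    irrefl : ∀ {x} → ¬ Adj x x
open Graph public

FinGraph : ℕ → Set₁
FinGraph n = Graph (Fin n)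

record VSet (V : Set) : Set where
  constructor vset
  field
    elems  : List V
    unique : Unique elems
open VSet public

∣_∣ : ∀ {V} → VSet V → ℕ
∣ D ∣ = length (elems D)

_∈ˢ_ : ∀ {V} → V → VSet V → Set
x ∈ˢ D = x ∈ elems D

Dominating : ∀ {V} → Graph V → VSet V → Set
Dominating {V} G D = ∀ (v : V) → ¬ (v ∈ˢ D) → ∃[ u ] (u ∈ˢ D × Adj G v u)

IsDominationNumber : ∀ {V} → Graph V → ℕ → Set
IsDominationNumber {V} G k =
  (∃[ D ] (Dominating G D × ∣ D ∣ ≡ k)) × (∀ (D : VSet V) → Dominating G D → k ≤ ∣ D ∣)

IsGammaSet : ∀ {V} → Graph V → ℕ → VSet V → Set
IsGammaSet G k D = Dominating G D × ∣ D ∣ ≡ k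

_≐_ : ∀ {V} → VSet V → VSet V → Set
D ≐ E = ∀ x → (x ∈ˢ D → x ∈ˢ E) × (x ∈ˢ E → x ∈ˢ D)

SierpAdj : ∀ {n t} → FinGraph n → Vec (Fin n) t → Vec (Fin n) t → Set
SierpAdj {n} {t} G u v =
  ∃[ i ] ( (∀ (j : Fin t) → j < i → lookup u j ≡ lookup v j)
         × ¬ (lookup u i ≡ lookup v i)
         × Adj G (lookup u i) (lookup v i)
         × (∀ (j : Fin t) → i < j → (lookup u j ≡ lookup v i × lookup v j ≡ lookup u i)) )


S : ∀ {n} → FinGraph n → (t : ℕ) → Graph (Vec (Fin n) t)
S {n} G t = record { Adj = SierpAdj G ; sym = λ {u} {v} → s {u} {v} ; irrefl = λ {u} → ir {u} }
  where
    s : ∀ {u v} → SierpAdj G u v → SierpAdj G v u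
    s {u} {v} (i , pre , ne , a , post) =
      i , (λ j j<i → Relation.Binary.PropositionalEquality.sym (pre j j<i))
        , (λ e → ne (Relation.Binary.PropositionalEquality.sym e))
        , Graph.sym G a
        , (λ j i<j → let (p , q) = post j i<j in q , p)
    ir : ∀ {u} → ¬ SierpAdj G u u
    ir {u} (i , _ , ne , _) = ne refl

module Submission where

-- Let t = m + 3.  Suppose D and D' are dominating sets of G of size g with
-- a ∈ D, c ∈ D' and c adjacent to a.  We build a dominating set of S(G,t)
-- with fewer than n^(t-1)·g vertices, so γ(S(G,t)) = n^(t-1)·g is impossible.
-- S(G,t) is the union of the n^(t-1) copies w·G = {w x : x ∈ V} of G
-- (w a word of length t-1); choosing a list σ(w) of letters in every copy
-- gives the "blow-up" {w y : y ∈ σ(w)}.  With q = a^m, w₀ = q c a and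
-- w₁ = q a c we take σ(w₀) = D ∖ {a}, σ(w₁) = D' and σ(w) = D otherwise:
-- the vertex w₀ a is dominated from the copy w₁ (edge q c a a ~ q a c c),
-- and a vertex w₀ x whose only dominator in D is a is dominated by
-- q c x a in the copy q c x (edge q c a x ~ q c x a).
--
-- Finally, if D and E are γ(G)-sets
-- and x ∈ E ∖ D, a neighbour a ∈ D of x gives such a pair (a, c = x); hence
-- E ⊆ D, symmetrically D ⊆ E, and the γ(G)-set is unique.

open import Defs
open import Data.Nat using (ℕ; zero; suc; _*_; _^_; _∸_; _≥_; _+_; _≤_; _<_; s≤s; z≤n)
open import Data.Nat.Properties
  using (≤-reflexive; <⇒≤; <⇒≱; +-mono-≤; +-mono-<-≤; +-mono-≤-<)
open import Data.Product using (∃-syntax; _×_; _,_)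
open import Data.Sum using (_⊎_; inj₁; inj₂)
open import Data.Bool using (true; false; if_then_else_)
open import Data.Fin using (Fin)
import Data.Fin as Fin
import Data.Fin.Properties as Fin using (_≟_)
open import Data.Vec using (Vec; []; _∷_; _∷ʳ_; lookup; replicate; initLast)
open import Data.Vec.Properties using (lookup-replicate; ∷ʳ-injectiveˡ; ∷ʳ-injectiveʳ; ≡-dec)
open import Data.List as List
  using (List; length; map; filter; concatMap; deduplicate; cartesianProductWith; allFin; [_])
open import Data.List.Properties
  using (length-++; length-map; length-tabulate; length-deduplicate; filter-notAll)
open import Data.List.Membership.Propositional using (_∈_; lose)
open import Data.List.Membership.Propositional.Properties
  using (∈-map⁺; ∈-concatMap⁺; ∈-deduplicate⁺; ∈-filter⁺; ∈-allFin; ∈-cartesianProductWith⁺)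
import Data.List.Membership.DecPropositional as DecMembership
open import Data.List.Relation.Unary.Any using (here; there)
open import Data.List.Relation.Unary.Unique.DecPropositional.Properties using (deduplicate-!)
open import Relation.Nullary using (yes; no; does; ¬?; contradiction)
open import Relation.Nullary.Decidable using (dec-true; dec-false)
open import Relation.Binary.Definitions using (DecidableEquality)
open import Relation.Binary.PropositionalEquality
  using (_≡_; _≢_; refl; cong; cong₂; subst; trans)
import Relation.Binary.PropositionalEquality as ≡

Dominated : ∀ {V} → Graph V → VSet V → V → Set
Dominated G X v = v ∈ˢ X ⊎ ∃[ u ] (u ∈ˢ X × Adj G v u)

dominating : ∀ {V} (G : Graph V) (X : VSet V) → (∀ v → Dominated G X v) → Dominating G X
dominating G X dom v v∉X with dom v
... | inj₁ v∈X = contradiction v∈X v∉X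
... | inj₂ neighbour = neighbour

dominated : ∀ {n} (G : FinGraph n) (X : VSet (Fin n)) → Dominating G X → ∀ x → Dominated G X x
dominated G X dom x with DecMembership._∈?_ Fin._≟_ x (elems X)
... | yes x∈X = inj₁ x∈X
... | no x∉X = inj₂ (dom x x∉X)

module Adjacency {n : ℕ} (G : FinGraph n) where

  adj⇒≢ : ∀ {x y} → Adj G x y → x ≢ y
  adj⇒≢ xy refl = irrefl G xy

  ∷-adj : ∀ {t} (z : Fin n) {u v : Vec (Fin n) t} → SierpAdj G u v → SierpAdj G (z ∷ u) (z ∷ v)
  ∷-adj z {u} {v} (i , before , u≢v , uv , after) = Fin.suc i , before′ , u≢v , uv , after′
    where
      before′ : ∀ j → j Fin.< Fin.suc i → lookup (z ∷ u) j ≡ lookup (z ∷ v) j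
      before′ Fin.zero _ = refl
      before′ (Fin.suc j) (s≤s j<i) = before j j<i
      after′ : ∀ j → Fin.suc i Fin.< j →
        lookup (z ∷ u) j ≡ lookup v i × lookup (z ∷ v) j ≡ lookup u i
      after′ Fin.zero ()
      after′ (Fin.suc j) (s≤s i<j) = after j i<j

  swap-adj : ∀ l {a b} → Adj G a b → SierpAdj G (a ∷ replicate l b) (b ∷ replicate l a)
  swap-adj l {a} {b} ab = Fin.zero , (λ _ ()) , adj⇒≢ ab , ab , after
    where
      after : ∀ j → Fin.zero {l} Fin.< j →
        lookup (a ∷ replicate l b) j ≡ b × lookup (b ∷ replicate l a) j ≡ a
      after Fin.zero ()
      after (Fin.suc j) _ = lookup-replicate j b , lookup-replicate j a

  copy-adj : ∀ {k} (w : Vec (Fin n) k) {x y} → Adj G x y → SierpAdj G (w ∷ʳ x) (w ∷ʳ y)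
  copy-adj [] xy = swap-adj 0 xy
  copy-adj (z ∷ w) xy = ∷-adj z (copy-adj w xy)

  _⊕_ : ∀ {k} → Vec (Fin n) k → Vec (Fin n) 3 → Vec (Fin n) (3 + k)
  q ⊕ (c ∷ a ∷ x ∷ []) = ((q ∷ʳ c) ∷ʳ a) ∷ʳ x

  ⊕-adj : ∀ {k} (q : Vec (Fin n) k) (s s′ : Vec (Fin n) 3) → SierpAdj G s s′ → SierpAdj G (q ⊕ s) (q ⊕ s′)
  ⊕-adj [] (_ ∷ _ ∷ _ ∷ []) (_ ∷ _ ∷ _ ∷ []) ss′ = ss′
  ⊕-adj (z ∷ q) s@(_ ∷ _ ∷ _ ∷ []) s′@(_ ∷ _ ∷ _ ∷ []) ss′ = ∷-adj z (⊕-adj q s s′ ss′)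

length-cartesianProductWith : ∀ {A B C : Set} (f : A → B → C) (xs : List A) (ys : List B) →
  length (cartesianProductWith f xs ys) ≡ length xs * length ys
length-cartesianProductWith f List.[] ys = refl
length-cartesianProductWith f (x List.∷ xs) ys = trans (length-++ (map (f x) ys))
  (cong₂ _+_ (length-map (f x) ys) (length-cartesianProductWith f xs ys))

words : ∀ n k → List (Vec (Fin n) k)
words n zero = [ [] ]
words n (suc k) = cartesianProductWith _∷_ (allFin n) (words n k)

∈-words : ∀ {n k} (w : Vec (Fin n) k) → w ∈ words n k
∈-words [] = here refl
∈-words (x ∷ w) = ∈-cartesianProductWith⁺ _∷_ (∈-allFin x) (∈-words w)

length-words : ∀ n k → length (words n k) ≡ n ^ k
length-words n zero = refl
length-words n (suc k) = trans (length-cartesianProductWith _∷_ (allFin n) (words n k))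
  (cong₂ _*_ (length-tabulate {n = n} (λ i → i)) (length-words n k))

module _ {A B : Set} (f : A → List B) {g : ℕ} (f≤g : ∀ x → length (f x) ≤ g) where

  length-concatMap-≤ : ∀ xs → length (concatMap f xs) ≤ length xs * g
  length-concatMap-≤ List.[] = z≤n
  length-concatMap-≤ (x List.∷ xs) = subst (_≤ g + length xs * g) (≡.sym (length-++ (f x)))
    (+-mono-≤ (f≤g x) (length-concatMap-≤ xs))

  length-concatMap-< : ∀ {x₀} xs → x₀ ∈ xs → length (f x₀) < g → length (concatMap f xs) < length xs * g
  length-concatMap-< (x List.∷ xs) (here refl) fx<g =
    subst (_< g + length xs * g) (≡.sym (length-++ (f x))) (+-mono-<-≤ fx<g (length-concatMap-≤ xs))
  length-concatMap-< (x List.∷ xs) (there x₀∈xs) fx₀<g =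
    subst (_< g + length xs * g) (≡.sym (length-++ (f x)))
      (+-mono-≤-< (f≤g x) (length-concatMap-< xs x₀∈xs fx₀<g))

module Blowup {n k : ℕ} (σ : Vec (Fin n) k → List (Fin n)) where

  private
    _≟_ : DecidableEquality (Vec (Fin n) (suc k))
    _≟_ = ≡-dec Fin._≟_

    copy : Vec (Fin n) k → List (Vec (Fin n) (suc k))
    copy w = map (w ∷ʳ_) (σ w)

    copies : List (Vec (Fin n) (suc k))
    copies = concatMap copy (words n k)

  blowup : VSet (Vec (Fin n) (suc k))
  blowup = vset (deduplicate _≟_ copies) (deduplicate-! _≟_ copies)

  ∈-blowup : ∀ {w y} → y ∈ σ w → (w ∷ʳ y) ∈ˢ blowup
  ∈-blowup {w} y∈σw = ∈-deduplicate⁺ _≟_ (∈-concatMap⁺ copy (lose (∈-words w) (∈-map⁺ (w ∷ʳ_) y∈σw)))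

  ∣blowup∣< : ∀ {g} w₀ → (∀ w → length (σ w) ≤ g) → length (σ w₀) < g → ∣ blowup ∣ < n ^ k * g
  ∣blowup∣< {g} w₀ σ≤g σw₀<g = begin-strict
    ∣ blowup ∣             ≤⟨ length-deduplicate _≟_ copies ⟩
    length copies          <⟨ length-concatMap-< copy copy≤g (words n k) (∈-words w₀) copyw₀<g ⟩
    length (words n k) * g ≡⟨ cong (_* g) (length-words n k) ⟩
    n ^ k * g              ∎
    where
      open Data.Nat.Properties.≤-Reasoning
      copy≤g : ∀ w → length (copy w) ≤ g
      copy≤g w = subst (_≤ g) (≡.sym (length-map (w ∷ʳ_) (σ w))) (σ≤g w)
      copyw₀<g : length (copy w₀) < g
      copyw₀<g = subst (_< g) (≡.sym (length-map (w₀ ∷ʳ_) (σ w₀))) σw₀<g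

  lift-dominated : ∀ (G : FinGraph n) (E : VSet (Fin n)) w {x} → (∀ {y} → y ∈ˢ E → y ∈ σ w) →
    Dominated G E x → Dominated (S G (suc k)) blowup (w ∷ʳ x)
  lift-dominated G E w E⊆σw (inj₁ x∈E) = inj₁ (∈-blowup (E⊆σw x∈E))
  lift-dominated G E w E⊆σw (inj₂ (y , y∈E , xy)) =
    inj₂ (w ∷ʳ y , ∈-blowup (E⊆σw y∈E) , Adjacency.copy-adj G w xy)

module Update {W B : Set} (_≟_ : DecidableEquality W) where

  _[_≔_] : (W → B) → W → B → W → B
  (σ [ w₀ ≔ b ]) w = if does (w ≟ w₀) then b else σ w

  update-at : ∀ σ w₀ b → (σ [ w₀ ≔ b ]) w₀ ≡ b
  update-at σ w₀ b = cong (if_then b else σ w₀) (dec-true (w₀ ≟ w₀) refl)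

  update-other : ∀ σ {w₀} b {w} → w ≢ w₀ → (σ [ w₀ ≔ b ]) w ≡ σ w
  update-other σ b {w} w≢w₀ = cong (if_then b else σ w) (dec-false (w ≟ _) w≢w₀)

  update-preserves : ∀ (P : B → Set) {σ w₀ b} → P b → (∀ w → P (σ w)) → ∀ w → P ((σ [ w₀ ≔ b ]) w)
  update-preserves P {w₀ = w₀} Pb Pσ w with does (w ≟ w₀)
  ... | true = Pb
  ... | false = Pσ w

module Shrink {n : ℕ} (G : FinGraph n) (m g : ℕ) {D D′ : VSet (Fin n)} {a c : Fin n}
  (domD : Dominating G D) (∣D∣≡g : ∣ D ∣ ≡ g) (domD′ : Dominating G D′) (∣D′∣≡g : ∣ D′ ∣ ≡ g)
  (a∈D : a ∈ˢ D) (c∈D′ : c ∈ˢ D′) (ca : Adj G c a) where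

  open Adjacency G
  open Update {Vec (Fin n) (suc (suc m))} {List (Fin n)} (≡-dec Fin._≟_)

  q : Vec (Fin n) m
  q = replicate m a

  w₀ w₁ : Vec (Fin n) (suc (suc m))
  w₀ = (q ∷ʳ c) ∷ʳ a
  w₁ = (q ∷ʳ a) ∷ʳ c

  D∖a : List (Fin n)
  D∖a = filter (λ y → ¬? (y Fin.≟ a)) (elems D)

  σ₁ σ : Vec (Fin n) (suc (suc m)) → List (Fin n)
  σ₁ = (λ _ → elems D) [ w₁ ≔ elems D′ ]
  σ = σ₁ [ w₀ ≔ D∖a ]

  open Blowup σ using (blowup; ∈-blowup; ∣blowup∣<; lift-dominated)

  c≢a : c ≢ a
  c≢a = adj⇒≢ ca

  w₁≢w₀ : w₁ ≢ w₀
  w₁≢w₀ eq = c≢a (≡.sym (∷ʳ-injectiveʳ q q (∷ʳ-injectiveˡ (q ∷ʳ a) (q ∷ʳ c) eq)))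

  ∈σ-w₀ : ∀ {y} → y ∈ D∖a → y ∈ σ w₀
  ∈σ-w₀ = subst (_ ∈_) (≡.sym (update-at σ₁ w₀ D∖a))

  ∈σ-w₁ : ∀ {y} → y ∈ˢ D′ → y ∈ σ w₁
  ∈σ-w₁ = subst (_ ∈_)
    (≡.sym (trans (update-other σ₁ D∖a w₁≢w₀) (update-at (λ _ → elems D) w₁ (elems D′))))

  ∈σ-other : ∀ {w y} → w ≢ w₀ → w ≢ w₁ → y ∈ˢ D → y ∈ σ w
  ∈σ-other w≢w₀ w≢w₁ = subst (_ ∈_)
    (≡.sym (trans (update-other σ₁ D∖a w≢w₀) (update-other (λ _ → elems D) (elems D′) w≢w₁)))

  ∣D∖a∣<g : length D∖a < g
  ∣D∖a∣<g = subst (length D∖a <_) ∣D∣≡g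
    (filter-notAll (λ y → ¬? (y Fin.≟ a)) (elems D) (lose a∈D λ a≢a → a≢a refl))

  σ≤g : ∀ w → length (σ w) ≤ g
  σ≤g = update-preserves (λ L → length L ≤ g) {σ₁} (<⇒≤ ∣D∖a∣<g)
    (update-preserves (λ L → length L ≤ g) {λ _ → elems D} (≤-reflexive ∣D′∣≡g) (λ _ → ≤-reflexive ∣D∣≡g))

  -- The copy w₀ = q c a, which lacks a, is still dominated: w₀ a via the
  -- edge q c a a ~ q a c c (c ∈ σ(w₁) = D′), and w₀ x with only the
  -- dominator a via the edge q c a x ~ q c x a (a ∈ σ(q c x) = D).
  dominated-w₀ : ∀ x → Dominated (S G (3 + m)) blowup (w₀ ∷ʳ x)
  dominated-w₀ x with x Fin.≟ a
  ... | yes refl = inj₂ (w₁ ∷ʳ c , ∈-blowup (∈σ-w₁ c∈D′) ,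
                         ⊕-adj q (c ∷ a ∷ a ∷ []) (a ∷ c ∷ c ∷ []) (swap-adj 2 ca))
  ... | no x≢a with dominated G D domD x
  ...   | inj₁ x∈D = inj₁ (∈-blowup (∈σ-w₀ (∈-filter⁺ _ x∈D x≢a)))
  ...   | inj₂ (y , y∈D , xy) with y Fin.≟ a
  ...     | no y≢a = inj₂ (w₀ ∷ʳ y , ∈-blowup (∈σ-w₀ (∈-filter⁺ _ y∈D y≢a)) , copy-adj w₀ xy)
  ...     | yes refl = inj₂ (w ∷ʳ a , ∈-blowup (∈σ-other w≢w₀ w≢w₁ a∈D) ,
                             ⊕-adj q (c ∷ a ∷ x ∷ []) (c ∷ x ∷ a ∷ []) (∷-adj c (swap-adj 1 (Graph.sym G xy))))
    where
      w : Vec (Fin n) (suc (suc m))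
      w = (q ∷ʳ c) ∷ʳ x
      w≢w₀ : w ≢ w₀
      w≢w₀ eq = x≢a (∷ʳ-injectiveʳ (q ∷ʳ c) (q ∷ʳ c) eq)
      w≢w₁ : w ≢ w₁
      w≢w₁ eq = c≢a (∷ʳ-injectiveʳ q q (∷ʳ-injectiveˡ (q ∷ʳ c) (q ∷ʳ a) eq))

  -- Every other copy contains a full dominating set D or D′.
  dominated-all : ∀ v → Dominated (S G (3 + m)) blowup v
  dominated-all v with initLast v
  ... | w , x , refl with ≡-dec Fin._≟_ w w₀
  ...   | yes refl = dominated-w₀ x
  ...   | no w≢w₀ with ≡-dec Fin._≟_ w w₁
  ...     | yes refl = lift-dominated G D′ w₁ ∈σ-w₁ (dominated G D′ domD′ x)
  ...     | no w≢w₁ = lift-dominated G D w (∈σ-other w≢w₀ w≢w₁) (dominated G D domD x)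

  small-dominating-set : ∃[ X ] (Dominating (S G (3 + m)) X × ∣ X ∣ < n ^ (2 + m) * g)
  small-dominating-set = blowup , dominating (S G (3 + m)) blowup dominated-all , ∣blowup∣< {g} w₀ σ≤g ∣σw₀∣<g
    where
      ∣σw₀∣<g : length (σ w₀) < g
      ∣σw₀∣<g = subst (λ L → length L < g) (≡.sym (update-at σ₁ w₀ D∖a)) ∣D∖a∣<g

γ-set-⊆ : ∀ {n} (G : FinGraph n) m {g} → IsDominationNumber (S G (3 + m)) (n ^ (2 + m) * g) →
  ∀ E D → IsGammaSet G g E → IsGammaSet G g D → ∀ x → x ∈ˢ E → x ∈ˢ D
γ-set-⊆ G m {g} (_ , minimal) E D (domE , ∣E∣≡g) (domD , ∣D∣≡g) x x∈E with dominated G D domD x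
... | inj₁ x∈D = x∈D
... | inj₂ (a , a∈D , xa) with Shrink.small-dominating-set G m g {D} {E} domD ∣D∣≡g domE ∣E∣≡g a∈D x∈E xa
...   | X , domX , ∣X∣< = contradiction (minimal X domX) (<⇒≱ ∣X∣<)

lemma14 : ∀ (n : ℕ) (G : FinGraph n) (t : ℕ) → t ≥ 3 → (g : ℕ) →
    IsDominationNumber G g →
    IsDominationNumber (S G t) (n ^ (t ∸ 1) * g) →
    ∃[ D ] (IsGammaSet G g D × (∀ E → IsGammaSet G g E → E ≐ D))
lemma14 n G (suc (suc (suc m))) (s≤s (s≤s (s≤s _))) g ((D , γD) , _) γS =
  D , γD , λ E γE x → γ-set-⊆ G m γS E D γE γD x , γ-set-⊆ G m γS D E γD γE x
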